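{- Let $n>1$ be an odd integer having at most two distinct prime divisors. Let $G$ be the complement of the unitary Cayley graph of order $n$, i.e. the graph with vertex set $\mathbb{Z}_n$ in which distinct vertices $x,y$ are adjacent if and only if $\gcd(x-y,n)>1$. Then $ch(G)=\chi(G)$, where $ch$ denotes the choice number and $\chi$ the chromatic number.
   Context: The choice number $ch(G)$ of a graph $G$ is the least integer $k$ such that for every assignment of lists of $k$ colors to the vertices of $G$ there is a proper coloring of $G$ choosing each vertex's color from its list. The unitary Cayley graph of order $n$ is the Cayley graph on $\mathbb{Z}_n$ whose generating set is the set of residues coprime to $n$; its complement is the graph described in the claim. -}

module Defs where

open import Data.Nat using (ℕ; _<_; _>_; _≤_; ∣_-_∣)
open import Data.Nat.GCD using (gcd)
open import Data.Nat.Divisibility using (_∣_)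
open import Data.Nat.Primality using (Prime)
open import Data.Fin using (Fin; toℕ)
open import Data.List using (List; length)
open import Data.List.Membership.Propositional using (_∈_)
open import Data.List.Relation.Unary.Unique.Propositional using (Unique)
open import Data.Product using (Σ; _×_; ∃)
open import Data.Sum using (_⊎_)
open import Relation.Nullary using (¬_)
open import Relation.Binary.PropositionalEquality using (_≡_)

Graph : ℕ → Set₁
Graph n = Fin n → Fin n → Set

-- Complement of the unitary Cayley graph of order n on ℤ_n ≅ Fin n:
-- distinct x, y adjacent iff gcd(x - y, n) > 1.
-- (gcd(|x - y|, n) equals gcd((x - y) mod n, n).)
CoUnitaryCayley : (n : ℕ) → Graph n
CoUnitaryCayley n x y = ¬ (x ≡ y) × gcd ∣ toℕ x - toℕ y ∣ n > 1

Proper : {n : ℕ} → Graph n → (Fin n → ℕ) → Set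
Proper G c = ∀ x y → G x y → ¬ (c x ≡ c y)

Colorable : {n : ℕ} → Graph n → ℕ → Set
Colorable {n} G k = Σ (Fin n → ℕ) λ c → Proper G c × (∀ x → c x < k)

Choosable : {n : ℕ} → Graph n → ℕ → Set
Choosable {n} G k =
  (L : Fin n → List ℕ) → (∀ x → Unique (L x)) → (∀ x → length (L x) ≡ k) →
  Σ (Fin n → ℕ) λ c → Proper G c × (∀ x → c x ∈ L x)

IsLeast : (ℕ → Set) → ℕ → Set
IsLeast P k = P k × (∀ j → P j → k ≤ j)

ChromaticNumber : {n : ℕ} → Graph n → ℕ → Set
ChromaticNumber G k = IsLeast (Colorable G) k

ChoiceNumber : {n : ℕ} → Graph n → ℕ → Set
ChoiceNumber G k = IsLeast (Choosable G) k

AtMostTwoPrimeDivisors : ℕ → Set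
AtMostTwoPrimeDivisors n =
  ∀ p q r → Prime p → Prime q → Prime r → p ∣ n → q ∣ n → r ∣ n →
  p ≡ q ⊎ p ≡ r ⊎ q ≡ r

{-# OPTIONS --safe #-}
module Submission where

-- Let p ≤ q be the prime divisors of n (p = q for a prime power). If gcd(x − y, n) > 1 then x ≡ y
-- modulo p or modulo q, so x ↦ (x mod p, x mod q) embeds G into the line graph of a bipartite
-- multigraph, and x ↦ ⌊x/p⌋ is a proper edge colouring of it with n/p colours: x is determined by
-- ⌊x/p⌋ together with x mod p, and also together with x mod q because p ≤ q. By Galvin's theorem
-- that line graph is n/p-choosable: orient each edge towards the larger colour within a row and
-- the smaller colour within a column; Gale–Shapley stable matchings provide kernels of every
-- induced subgraph, and the Bondy–Boppana–Siegel kernel lemma turns out-degrees below n/p into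
-- list colourings. The n/p multiples of p form a clique, so n/p ≤ χ ≤ ch ≤ n/p.

open import Defs
open import Data.Empty using (⊥-elim)
open import Data.Fin using (Fin; toℕ; fromℕ<; zero; suc)
open import Data.Fin.Properties using (suc-injective; 0≢1+n; toℕ-injective; toℕ-fromℕ<; toℕ<n; injective⇒≤; all?; any?)
  renaming (_≟_ to _≟ᶠ_)
open import Data.Fin.Subset using (Subset; _∈_; _∉_; _⊆_; _⊂_; _─_; _∩_; ∁; ⊤; ⁅_⁆; ∣_∣; outside; inside)
open import Data.Fin.Subset.Induction using (⊂-wellFounded; Acc; acc)
open import Data.Fin.Subset.Properties
  using (x∈p∧x≢y⇒x∈p-y; x∈p⇒∣p-x∣<∣p∣; ∈⊤; ∣⊤∣≡n; x∈p∩q⁺; x∈p∩q⁻; x∉p⇒x∈∁p; x∈∁p⇒x∉p;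
         p∩q⊆p; p─q⊆p; x∈p⇒p-x⊂p; p⊆q⇒∣p∣≤∣q∣; p⊂q⇒∣p∣<∣q∣; ∣p∩q∣≤∣q∣; nonempty?; _∈?_)
open import Data.List using (List; []; _∷_; length; filter; take; upTo; lookup; allFin)
open import Data.List.Extrema.Nat using (argmax; argmax-all; f[⊥]≤f[argmax]; f[xs]≤f[argmax])
open import Data.List.Membership.Propositional using () renaming (_∈_ to _∈ₗ_; _∉_ to _∉ₗ_)
open import Data.List.Membership.Propositional.Properties using (∈-filter⁺; ∈-filter⁻; ∈-upTo⁻; ∈-lookup; ∈-allFin)
open import Data.List.Properties using (filter-all; filter-accept; filter-reject; length-take; length-upTo)
open import Data.List.Relation.Binary.Sublist.Propositional.Properties using (take-⊆; Any-resp-⊆)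
open import Data.List.Relation.Unary.All as All using (All; _∷_)
open import Data.List.Relation.Unary.All.Properties using (¬Any⇒All¬; all-filter)
open import Data.List.Relation.Unary.AllPairs using ([]; _∷_)
open import Data.List.Relation.Unary.Any using (here; there)
open import Data.List.Relation.Unary.Unique.Propositional using (Unique)
import Data.List.Relation.Unary.Unique.Propositional.Properties as Unique
open import Data.Nat using (ℕ; suc; _≤_; _<_; _>_; z≤n; s≤s; s<s; s<s⁻¹; z<s; _⊓_; _⊔_; _∸_; _*_; _+_; _≟_; _<?_; _≤?_;
  ∣_-_∣; _%_; _/_; NonZero; >-nonZero; ≢-nonZero; ≢-nonZero⁻¹; nonTrivial⇒n>1)
open import Data.Nat.DivMod using (m≡m%n+[m/n]*n; %-remove-+ʳ; m<n⇒m%n≡m; m%n<n; m<n*o⇒m/o<n; m/n*n≡m)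
open import Data.Nat.Divisibility using (_∣_; divides; _∣?_; ∣-trans; ∣⇒≤; m∣m*n; n∣m⇒m%n≡0)
open import Data.Nat.GCD using (gcd; gcd[m,n]∣m; gcd[m,n]∣n; gcd-greatest; gcd[m,n]≢0)
open import Data.Nat.ListAction using (product)
open import Data.Nat.Primality using (Prime; prime?; prime⇒nonZero; prime⇒nonTrivial)
open import Data.Nat.Primality.Factorisation using (factorise)
open import Data.List.Membership.DecPropositional _≟_ using () renaming (_∈?_ to _∈ₗ?_)
open import Data.Nat.Properties hiding (suc-injective; 0≢1+n)
open import Data.Product using (Σ; ∃-syntax; _×_; _,_; proj₁; proj₂)
open import Data.Sum using (_⊎_; inj₁; inj₂; [_,_]′; swap)
open import Data.Vec using (tabulate; []; _∷_; here; there)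
open import Data.Vec.Properties using (lookup∘tabulate; []=⇒lookup; lookup⇒[]=)
open import Function using (_∘_; id)
open import Relation.Nullary using (¬_; Dec; yes; no; does)
open import Relation.Nullary.Decidable using (dec-true; ¬?; _×-dec_; _⊎-dec_; _→-dec_)
open import Relation.Unary using (Decidable)
open import Relation.Binary.PropositionalEquality
  using (_≡_; _≢_; refl; sym; trans; cong; cong₂; subst; ≢-sym; module ≡-Reasoning)
open import Relation.Binary.Definitions using (tri<; tri≈; tri>)

⟪_⟫ : ∀ {n} {P : Fin n → Set} → Decidable P → Subset n
⟪ P? ⟫ = tabulate (does ∘ P?)

∈⟪⟫⁺ : ∀ {n} {P : Fin n → Set} (P? : Decidable P) {x} → P x → x ∈ ⟪ P? ⟫
∈⟪⟫⁺ P? {x} px = lookup⇒[]= x _ (trans (lookup∘tabulate _ x) (dec-true (P? x) px))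

∈⟪⟫⁻ : ∀ {n} {P : Fin n → Set} (P? : Decidable P) {x} → x ∈ ⟪ P? ⟫ → P x
∈⟪⟫⁻ P? {x} x∈P with P? x | trans (sym (lookup∘tabulate (does ∘ P?) x)) ([]=⇒lookup x∈P)
... | yes px | _  = px
... | no _   | ()

∩-monoˡ : ∀ {n} {p q r : Subset n} → p ⊆ q → p ∩ r ⊆ q ∩ r
∩-monoˡ {p = p} {r = r} p⊆q x∈p∩r =
  let x∈p , x∈r = x∈p∩q⁻ p r x∈p∩r in x∈p∩q⁺ (p⊆q x∈p , x∈r)

injective⇒∣p∣≤∣q∣ : ∀ {m n} {p : Subset m} {q : Subset n} (f : Fin m → Fin n) →
                    (∀ {x} → x ∈ p → f x ∈ q) →
                    (∀ {x y} → x ∈ p → y ∈ p → f x ≡ f y → x ≡ y) →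
                    ∣ p ∣ ≤ ∣ q ∣
injective⇒∣p∣≤∣q∣ {p = []}          f _      _     = z≤n
injective⇒∣p∣≤∣q∣ {p = outside ∷ p} f f[p]⊆q f-inj =
  injective⇒∣p∣≤∣q∣ (f ∘ suc) (f[p]⊆q ∘ there) (λ x∈p y∈p → suc-injective ∘ f-inj (there x∈p) (there y∈p))
injective⇒∣p∣≤∣q∣ {p = inside ∷ p} {q} f f[p]⊆q f-inj = begin-strict
  ∣ p ∣
    ≤⟨ injective⇒∣p∣≤∣q∣ (f ∘ suc) f[p]⊆q─f0 (λ x∈p y∈p → suc-injective ∘ f-inj (there x∈p) (there y∈p)) ⟩
  ∣ q ─ ⁅ f zero ⁆ ∣
    <⟨ x∈p⇒∣p-x∣<∣p∣ (f[p]⊆q here) ⟩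
  ∣ q ∣
    ∎
  where
  open ≤-Reasoning
  f[p]⊆q─f0 : ∀ {x} → x ∈ p → f (suc x) ∈ q ─ ⁅ f zero ⁆
  f[p]⊆q─f0 x∈p = x∈p∧x≢y⇒x∈p-y (f[p]⊆q (there x∈p)) (λ eq → 0≢1+n (f-inj here (there x∈p) (sym eq)))

_≢?_ : (x y : ℕ) → Dec (x ≢ y)
x ≢? y = ¬? (x ≟ y)

delete : ℕ → List ℕ → List ℕ
delete α = filter (α ≢?_)

∈-delete⁻ : ∀ {α x} xs → x ∈ₗ delete α xs → x ∈ₗ xs × α ≢ x
∈-delete⁻ {α} xs = ∈-filter⁻ (α ≢?_)

delete-unique : ∀ α {xs} → Unique xs → Unique (delete α xs)
delete-unique α = Unique.filter⁺ (α ≢?_)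

delete-∉ : ∀ {α} xs → α ∉ₗ xs → delete α xs ≡ xs
delete-∉ {α} xs α∉xs = filter-all (α ≢?_) (¬Any⇒All¬ xs α∉xs)

length-delete : ∀ α {xs} → Unique xs → length xs ≤ suc (length (delete α xs))
length-delete α {[]}     []             = z≤n
length-delete α {x ∷ xs} (x∉xs ∷ uniq) with α ≟ x
... | yes refl = begin
  suc (length xs)                   ≡⟨ cong (suc ∘ length) (filter-all (α ≢?_) x∉xs) ⟨
  suc (length (delete α xs))        ≡⟨ cong (suc ∘ length) (filter-reject (α ≢?_) (λ α≢α → α≢α refl)) ⟨
  suc (length (delete α (x ∷ xs)))  ∎
  where open ≤-Reasoning
... | no α≢x   = begin
  suc (length xs)                   ≤⟨ s≤s (length-delete α uniq) ⟩
  suc (length (x ∷ delete α xs))    ≡⟨ cong (suc ∘ length) (filter-accept (α ≢?_) α≢x) ⟨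
  suc (length (delete α (x ∷ xs)))  ∎
  where open ≤-Reasoning

choosable-⊆ : ∀ {n k} {G H : Graph n} → (∀ {x y} → G x y → H x y) → Choosable H k → Choosable G k
choosable-⊆ G⊆H choose L uniq len =
  let c , proper , c∈L = choose L uniq len in c , (λ x y → proper x y ∘ G⊆H) , c∈L

choosable-mono : ∀ {n j k} {G : Graph n} → j ≤ k → Choosable G j → Choosable G k
choosable-mono {j = j} j≤k choose L uniq len =
  let c , proper , c∈L = choose (take j ∘ L) (Unique.take⁺ j ∘ uniq) length-take-j
  in c , proper , λ x → Any-resp-⊆ (take-⊆ j (L x)) (c∈L x)
  where
  length-take-j : ∀ x → length (take j (L x)) ≡ j
  length-take-j x = trans (length-take j (L x)) (trans (cong (j ⊓_) (len x)) (m≤n⇒m⊓n≡m j≤k))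

choosable⇒colorable : ∀ {n k} {G : Graph n} → Choosable G k → Colorable G k
choosable⇒colorable {k = k} choose =
  let c , proper , c∈upTo = choose (λ _ → upTo k) (λ _ → Unique.upTo⁺ k) (λ _ → length-upTo k)
  in c , proper , λ x → ∈-upTo⁻ (c∈upTo x)

clique⇒≤ : ∀ {n m k} {G : Graph n} (f : Fin m → Fin n) →
           (∀ {i j} → i ≢ j → G (f i) (f j)) → Colorable G k → m ≤ k
clique⇒≤ f clique (c , proper , c<k) = injective⇒≤ colourOf-injective
  where
  colourOf : Fin _ → Fin _
  colourOf i = fromℕ< (c<k (f i))
  colourOf-injective : ∀ {i j} → colourOf i ≡ colourOf j → i ≡ j
  colourOf-injective {i} {j} eq with i ≟ᶠ j
  ... | yes i≡j = i≡j
  ... | no i≢j  = ⊥-elim (proper (f i) (f j) (clique i≢j) (begin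
    c (f i)            ≡⟨ sym (toℕ-fromℕ< (c<k (f i))) ⟩
    toℕ (colourOf i)   ≡⟨ cong toℕ eq ⟩
    toℕ (colourOf j)   ≡⟨ toℕ-fromℕ< (c<k (f j)) ⟩
    c (f j)            ∎))
    where open ≡-Reasoning

chromaticNumber⇒choiceNumber : ∀ {n m k} {G : Graph n} → Choosable G m →
                               (∀ j → Colorable G j → m ≤ j) →
                               ChromaticNumber G k → ChoiceNumber G k
chromaticNumber⇒choiceNumber choose-m m≤ (colour-k , k-least) =
  choosable-mono (m≤ _ colour-k) choose-m , λ j choose-j → k-least j (choosable⇒colorable choose-j)

module KernelMethod {N : ℕ} (G : Graph N) {Arc : Fin N → Fin N → Set} (Arc? : ∀ u → Decidable (Arc u)) where

  record Kernel (S : Subset N) : Set where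
    field
      K           : Subset N
      K⊆S         : K ⊆ S
      independent : ∀ {u v} → u ∈ K → v ∈ K → ¬ G u v
      absorbing   : ∀ {u} → u ∈ S → u ∉ K → ∃[ w ] w ∈ K × Arc u w

  Out : Fin N → Subset N
  Out u = ⟪ Arc? u ⟫

  OutdegreeBelow : Subset N → (Fin N → List ℕ) → Set
  OutdegreeBelow S L = ∀ {u} → u ∈ S → ∣ S ∩ Out u ∣ < length (L u)

  ListColouring : Subset N → (Fin N → List ℕ) → Set
  ListColouring S L = Σ (Fin N → ℕ) λ f →
    (∀ {u} → u ∈ S → f u ∈ₗ L u) × (∀ {u v} → u ∈ S → v ∈ S → G u v → f u ≢ f v)

  module _ (kernelOf : ∀ S → Kernel S) where

    module ColourOneKernel (S : Subset N) (L : Fin N → List ℕ) (α : ℕ) where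

      Sα : Subset N
      Sα = S ∩ ⟪ (λ u → α ∈ₗ? L u) ⟫

      open Kernel (kernelOf Sα) renaming (K⊆S to K⊆Sα)

      S′ : Subset N
      S′ = S ∩ ∁ K

      L′ : Fin N → List ℕ
      L′ u = delete α (L u)

      ∈Sα⁺ : ∀ {u} → u ∈ S → α ∈ₗ L u → u ∈ Sα
      ∈Sα⁺ u∈S α∈Lu = x∈p∩q⁺ (u∈S , ∈⟪⟫⁺ (λ u → α ∈ₗ? L u) α∈Lu)

      ∈Sα⁻ : ∀ {u} → u ∈ Sα → u ∈ S × α ∈ₗ L u
      ∈Sα⁻ u∈Sα =
        let u∈S , u∈⟪⟫ = x∈p∩q⁻ S _ u∈Sα in u∈S , ∈⟪⟫⁻ (λ u → α ∈ₗ? L u) u∈⟪⟫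

      ∈S′⁺ : ∀ {u} → u ∈ S → u ∉ K → u ∈ S′
      ∈S′⁺ u∈S u∉K = x∈p∩q⁺ (u∈S , x∉p⇒x∈∁p u∉K)

      ∈S′⁻ : ∀ {u} → u ∈ S′ → u ∈ S × u ∉ K
      ∈S′⁻ u∈S′ = let u∈S , u∈∁K = x∈p∩q⁻ S (∁ K) u∈S′ in u∈S , x∈∁p⇒x∉p u∈∁K

      S′⊆S : S′ ⊆ S
      S′⊆S = p∩q⊆p S (∁ K)

      K⊆S : K ⊆ S
      K⊆S = proj₁ ∘ ∈Sα⁻ ∘ K⊆Sα

      K∩S′-disjoint : ∀ {u} → u ∈ K → u ∉ S′
      K∩S′-disjoint u∈K u∈S′ = proj₂ (∈S′⁻ u∈S′) u∈K

      S′⊂S : ∀ {u} → u ∈ S → α ∈ₗ L u → S′ ⊂ S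
      S′⊂S {u} u∈S α∈Lu with u ∈? K
      ... | yes u∈K = S′⊆S , u , u∈S , K∩S′-disjoint u∈K
      ... | no u∉K  = let w , w∈K , _ = absorbing (∈Sα⁺ u∈S α∈Lu) u∉K
                      in S′⊆S , w , K⊆S w∈K , K∩S′-disjoint w∈K

      outdegree-step : (∀ u → Unique (L u)) → OutdegreeBelow S L → OutdegreeBelow S′ L′
      outdegree-step uniq deg {u} u∈S′ with ∈S′⁻ u∈S′ | α ∈ₗ? L u
      ... | u∈S , _ | no α∉Lu = begin-strict
        ∣ S′ ∩ Out u ∣  ≤⟨ p⊆q⇒∣p∣≤∣q∣ (∩-monoˡ S′⊆S) ⟩
        ∣ S ∩ Out u ∣   <⟨ deg u∈S ⟩
        length (L u)    ≡⟨ cong length (delete-∉ (L u) α∉Lu) ⟨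
        length (L′ u)   ∎
        where open ≤-Reasoning
      ... | u∈S , u∉K | yes α∈Lu with absorbing (∈Sα⁺ u∈S α∈Lu) u∉K
      ...   | w , w∈K , arc = s<s⁻¹ (begin-strict
        suc ∣ S′ ∩ Out u ∣    <⟨ s<s (p⊂q⇒∣p∣<∣q∣ S′∩Out⊂S∩Out) ⟩
        suc ∣ S ∩ Out u ∣     ≤⟨ deg u∈S ⟩
        length (L u)          ≤⟨ length-delete α (uniq u) ⟩
        suc (length (L′ u))   ∎)
        where
        open ≤-Reasoning
        S′∩Out⊂S∩Out : S′ ∩ Out u ⊂ S ∩ Out u
        S′∩Out⊂S∩Out = ∩-monoˡ S′⊆S , w , x∈p∩q⁺ (K⊆S w∈K , ∈⟪⟫⁺ (Arc? u) arc) ,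
                       K∩S′-disjoint w∈K ∘ proj₁ ∘ x∈p∩q⁻ S′ (Out u)

      extend : ListColouring S′ L′ → ListColouring S L
      extend (f′ , f′∈L′ , f′-proper) = f , f∈L , f-proper
        where
        f : Fin N → ℕ
        f u with u ∈? K
        ... | yes _ = α
        ... | no _  = f′ u

        α≢f′ : ∀ {u} → u ∈ S → u ∉ K → α ≢ f′ u
        α≢f′ {u} u∈S u∉K = proj₂ (∈-delete⁻ (L u) (f′∈L′ (∈S′⁺ u∈S u∉K)))

        f∈L : ∀ {u} → u ∈ S → f u ∈ₗ L u
        f∈L {u} u∈S with u ∈? K
        ... | yes u∈K = proj₂ (∈Sα⁻ (K⊆Sα u∈K))
        ... | no u∉K  = proj₁ (∈-delete⁻ (L u) (f′∈L′ (∈S′⁺ u∈S u∉K)))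

        f-proper : ∀ {u v} → u ∈ S → v ∈ S → G u v → f u ≢ f v
        f-proper {u} {v} u∈S v∈S uv with u ∈? K | v ∈? K
        ... | yes u∈K | yes v∈K = ⊥-elim (independent u∈K v∈K uv)
        ... | yes _   | no v∉K  = α≢f′ v∈S v∉K
        ... | no u∉K  | yes _   = α≢f′ u∈S u∉K ∘ sym
        ... | no u∉K  | no v∉K  = f′-proper (∈S′⁺ u∈S u∉K) (∈S′⁺ v∈S v∉K) uv

    listColouring : ∀ {S} → Acc _⊂_ S → ∀ L → (∀ u → Unique (L u)) →
                    OutdegreeBelow S L → ListColouring S L
    listColouring {S} (acc smaller) L uniq deg with nonempty? S
    ... | no S-empty =
      (λ _ → 0) , (λ u∈S → ⊥-elim (S-empty (_ , u∈S))) , (λ u∈S → ⊥-elim (S-empty (_ , u∈S)))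
    ... | yes (u , u∈S) =
      extend (listColouring (smaller (S′⊂S u∈S α∈Lu)) L′ (delete-unique α ∘ uniq) (outdegree-step uniq deg))
      where
      -- any colour of L u will do; the out-degree bound shows that L u is nonempty
      i : Fin (length (L u))
      i = fromℕ< (deg u∈S)
      α : ℕ
      α = lookup (L u) i
      α∈Lu : α ∈ₗ L u
      α∈Lu = ∈-lookup i
      open ColourOneKernel S L α

  kernelPerfect⇒choosable : ∀ {k} → (∀ S → Kernel S) → (∀ u → ∣ Out u ∣ < k) → Choosable G k
  kernelPerfect⇒choosable {k} kernelOf out< L uniq len =
    let f , f∈L , f-proper = listColouring kernelOf (⊂-wellFounded ⊤) L uniq deg
    in f , (λ u v → f-proper ∈⊤ ∈⊤) , (λ u → f∈L ∈⊤)
    where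
    deg : OutdegreeBelow ⊤ L
    deg {u} _ = begin-strict
      ∣ ⊤ ∩ Out u ∣  ≤⟨ ∣p∩q∣≤∣q∣ ⊤ (Out u) ⟩
      ∣ Out u ∣      <⟨ out< u ⟩
      k              ≡⟨ len u ⟨
      length (L u)   ∎
      where open ≤-Reasoning

-- The line graph of the bipartite multigraph with one edge (row u, col u) for every vertex u.
Rook : ∀ {N} → (row col : Fin N → ℕ) → Graph N
Rook row col u v = u ≢ v × (row u ≡ row v ⊎ col u ≡ col v)

module Galvin {N : ℕ} (row col c : Fin N → ℕ)
  (row-injective : ∀ {u v} → row u ≡ row v → c u ≡ c v → u ≡ v)
  (col-injective : ∀ {u v} → col u ≡ col v → c u ≡ c v → u ≡ v) where

  Arc : Fin N → Fin N → Set
  Arc u w = (row u ≡ row w × c u < c w) ⊎ (col u ≡ col w × c w < c u)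

  Arc? : ∀ u → Decidable (Arc u)
  Arc? u w = (row u ≟ row w ×-dec c u <? c w) ⊎-dec (col u ≟ col w ×-dec c w <? c u)

  arc⇒c≢ : ∀ {u w} → Arc u w → c u ≢ c w
  arc⇒c≢ (inj₁ (_ , u<w)) = <⇒≢ u<w
  arc⇒c≢ (inj₂ (_ , w<u)) = >⇒≢ w<u

  arc-injective : ∀ {u w₁ w₂} → Arc u w₁ → Arc u w₂ → c w₁ ≡ c w₂ → w₁ ≡ w₂
  arc-injective     (inj₁ (r₁ , _))    (inj₁ (r₂ , _))    eq = row-injective (trans (sym r₁) r₂) eq
  arc-injective     (inj₂ (k₁ , _))    (inj₂ (k₂ , _))    eq = col-injective (trans (sym k₁) k₂) eq
  arc-injective {u} (inj₁ (_ , u<w₁)) (inj₂ (_ , w₂<u)) eq =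
    ⊥-elim (<-asym u<w₁ (subst (_< c u) (sym eq) w₂<u))
  arc-injective {u} (inj₂ (_ , w₁<u)) (inj₁ (_ , u<w₂)) eq =
    ⊥-elim (<-asym w₁<u (subst (c u <_) (sym eq) u<w₂))

  open KernelMethod (Rook row col) Arc? using (Kernel; Out; kernelPerfect⇒choosable)

  outdegree< : ∀ {Δ} → (∀ u → c u < Δ) → ∀ u → ∣ Out u ∣ < Δ
  outdegree< {Δ} c<Δ u = begin-strict
    ∣ Out u ∣           ≤⟨ injective⇒∣p∣≤∣q∣ colour Out⇒other-colour colour-injective ⟩
    ∣ ⊤ ─ ⁅ colour u ⁆ ∣ <⟨ x∈p⇒∣p-x∣<∣p∣ (∈⊤ {x = colour u}) ⟩
    ∣ ⊤ {Δ} ∣          ≡⟨ ∣⊤∣≡n Δ ⟩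
    Δ                  ∎
    where
    open ≤-Reasoning
    colour : Fin N → Fin Δ
    colour w = fromℕ< (c<Δ w)
    same-colour : ∀ {w₁ w₂} → colour w₁ ≡ colour w₂ → c w₁ ≡ c w₂
    same-colour {w₁} {w₂} eq =
      trans (sym (toℕ-fromℕ< (c<Δ w₁))) (trans (cong toℕ eq) (toℕ-fromℕ< (c<Δ w₂)))
    Out⇒other-colour : ∀ {w} → w ∈ Out u → colour w ∈ ⊤ ─ ⁅ colour u ⁆
    Out⇒other-colour w∈Out =
      x∈p∧x≢y⇒x∈p-y ∈⊤ (arc⇒c≢ (∈⟪⟫⁻ (Arc? u) w∈Out) ∘ sym ∘ same-colour)
    colour-injective : ∀ {w₁ w₂} → w₁ ∈ Out u → w₂ ∈ Out u → colour w₁ ≡ colour w₂ → w₁ ≡ w₂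
    colour-injective w₁∈Out w₂∈Out =
      arc-injective (∈⟪⟫⁻ (Arc? u) w₁∈Out) (∈⟪⟫⁻ (Arc? u) w₂∈Out) ∘ same-colour

  TopOfRow : Subset N → Fin N → Set
  TopOfRow T w = w ∈ T × (∀ v → v ∈ T → row v ≡ row w → c v ≤ c w)

  topOfRow? : ∀ T → Decidable (TopOfRow T)
  topOfRow? T w = w ∈? T ×-dec all? (λ v → v ∈? T →-dec (row v ≟ row w →-dec c v ≤? c w))

  tops : Subset N → Subset N
  tops T = ⟪ topOfRow? T ⟫

  top-exists : ∀ {T u} → u ∈ T → ∃[ w ] TopOfRow T w × row w ≡ row u × c u ≤ c w
  top-exists {T} {u} u∈T =
    w , (proj₁ w-rowMate , w-top) , proj₂ w-rowMate , f[⊥]≤f[argmax] {f = c} u rowMates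
    where
    RowMate : Fin N → Set
    RowMate v = v ∈ T × row v ≡ row u
    rowMate? : Decidable RowMate
    rowMate? v = v ∈? T ×-dec row v ≟ row u
    rowMates : List (Fin N)
    rowMates = filter rowMate? (allFin N)
    w : Fin N
    w = argmax c u rowMates
    w-rowMate : RowMate w
    w-rowMate = argmax-all c (u∈T , refl) (all-filter rowMate? (allFin N))
    w-top : ∀ v → v ∈ T → row v ≡ row w → c v ≤ c w
    w-top v v∈T row-v = All.lookup (f[xs]≤f[argmax] {f = c} u rowMates)
                          (∈-filter⁺ rowMate? (∈-allFin v) (v∈T , trans row-v (proj₂ w-rowMate)))

  top-unique : ∀ {T a b} → TopOfRow T a → TopOfRow T b → row a ≡ row b → a ≡ b
  top-unique (a∈T , a-top) (b∈T , b-top) row-ab =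
    row-injective row-ab (≤-antisym (b-top _ a∈T row-ab) (a-top _ b∈T (sym row-ab)))

  top-remove : ∀ {T b w} → TopOfRow T w → w ≢ b → TopOfRow (T ─ ⁅ b ⁆) w
  top-remove {T} {b} (w∈T , w-top) w≢b =
    x∈p∧x≢y⇒x∈p-y w∈T w≢b , λ v → w-top v ∘ p─q⊆p T ⁅ b ⁆

  Absorbed : Subset N → Subset N → Set
  Absorbed S T = ∀ {u} → u ∈ S → u ∉ T → ∃[ w ] TopOfRow T w × col w ≡ col u × c w < c u

  Conflict : Subset N → Set
  Conflict T = ∃[ a ] ∃[ b ] TopOfRow T a × TopOfRow T b × a ≢ b × col a ≡ col b

  conflict? : ∀ T → Dec (Conflict T)
  conflict? T = any? λ a → any? λ b →
    topOfRow? T a ×-dec topOfRow? T b ×-dec ¬? (a ≟ᶠ b) ×-dec col a ≟ col b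

  tops-kernel : ∀ {S T} → T ⊆ S → Absorbed S T → ¬ Conflict T → Kernel S
  tops-kernel {S} {T} T⊆S absorbed no-conflict = record
    { K           = tops T
    ; K⊆S         = T⊆S ∘ proj₁ ∘ ∈⟪⟫⁻ (topOfRow? T)
    ; independent = independent
    ; absorbing   = absorbing
    }
    where
    independent : ∀ {u v} → u ∈ tops T → v ∈ tops T → ¬ Rook row col u v
    independent u∈K v∈K (u≢v , inj₁ same-row) =
      u≢v (top-unique (∈⟪⟫⁻ (topOfRow? T) u∈K) (∈⟪⟫⁻ (topOfRow? T) v∈K) same-row)
    independent u∈K v∈K (u≢v , inj₂ same-col) =
      no-conflict (_ , _ , ∈⟪⟫⁻ (topOfRow? T) u∈K , ∈⟪⟫⁻ (topOfRow? T) v∈K , u≢v , same-col)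
    absorbing : ∀ {u} → u ∈ S → u ∉ tops T → ∃[ w ] w ∈ tops T × Arc u w
    absorbing {u} u∈S u∉K with u ∈? T
    ... | no u∉T  = let w , w-top , col-w , w<u = absorbed u∈S u∉T
                    in w , ∈⟪⟫⁺ (topOfRow? T) w-top , inj₂ (sym col-w , w<u)
    ... | yes u∈T with top-exists u∈T
    ...   | w , w-top , row-w , u≤w = w , w∈K , inj₁ (sym row-w , ≤∧≢⇒< u≤w c-u≢c-w)
      where
      w∈K : w ∈ tops T
      w∈K = ∈⟪⟫⁺ (topOfRow? T) w-top
      c-u≢c-w : c u ≢ c w
      c-u≢c-w eq = u∉K (subst (_∈ tops T) (sym (row-injective (sym row-w) eq)) w∈K)

  reject : ∀ {S T a b} → Absorbed S T → TopOfRow T a → a ≢ b → col a ≡ col b → c a < c b →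
           Absorbed S (T ─ ⁅ b ⁆)
  reject {S} {T} {a} {b} absorbed a-top a≢b col-ab a<b {u} u∈S u∉T-b with u ≟ᶠ b
  ... | yes refl = a , top-remove a-top a≢b , col-ab , a<b
  ... | no u≢b with absorbed u∈S (u∉T-b ∘ λ u∈T → x∈p∧x≢y⇒x∈p-y u∈T u≢b)
  ...   | w , w-top , col-w , w<u with w ≟ᶠ b
  ...     | yes refl = a , top-remove a-top a≢b , trans col-ab col-w , <-trans a<b w<u
  ...     | no w≢b   = w , top-remove w-top w≢b , col-w , w<u

  -- Rows propose: T holds the vertices not yet rejected, every row proposes to its top vertex in
  -- T, and of two tops in a common column the one with the larger colour is rejected.
  galeShapley : ∀ {S T} → Acc _⊂_ T → T ⊆ S → Absorbed S T → Kernel S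
  galeShapley {S} {T} (acc smaller) T⊆S absorbed with conflict? T
  ... | no no-conflict = tops-kernel T⊆S absorbed no-conflict
  ... | yes (a , b , a-top , b-top , a≢b , col-ab) with <-cmp (c a) (c b)
  ...   | tri< a<b _ _ = galeShapley (smaller (x∈p⇒p-x⊂p (proj₁ b-top))) (T⊆S ∘ p─q⊆p T ⁅ b ⁆)
                           (reject absorbed a-top a≢b col-ab a<b)
  ...   | tri≈ _ a≡b _ = ⊥-elim (a≢b (col-injective col-ab a≡b))
  ...   | tri> _ _ b<a = galeShapley (smaller (x∈p⇒p-x⊂p (proj₁ a-top))) (T⊆S ∘ p─q⊆p T ⁅ a ⁆)
                           (reject absorbed b-top (≢-sym a≢b) (sym col-ab) b<a)

  kernels : ∀ S → Kernel S
  kernels S = galeShapley (⊂-wellFounded S) id (λ u∈S u∉S → ⊥-elim (u∉S u∈S))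

  rook-choosable : ∀ {Δ} → (∀ u → c u < Δ) → Choosable (Rook row col) Δ
  rook-choosable c<Δ = kernelPerfect⇒choosable kernels (outdegree< c<Δ)

%≡%⇒∣∣-∣ : ∀ d .{{_ : NonZero d}} m n → m % d ≡ n % d → d ∣ ∣ m - n ∣
%≡%⇒∣∣-∣ d m n eq = divides ∣ m / d - n / d ∣ (begin
  ∣ m - n ∣                                  ≡⟨ cong₂ ∣_-_∣ (m≡m%n+[m/n]*n m d) (m≡m%n+[m/n]*n n d) ⟩
  ∣ m % d + m / d * d - n % d + n / d * d ∣  ≡⟨ cong (λ r → ∣ m % d + m / d * d - r + n / d * d ∣) eq ⟨
  ∣ m % d + m / d * d - m % d + n / d * d ∣  ≡⟨ ∣m+n-m+o∣≡∣n-o∣ (m % d) (m / d * d) (n / d * d) ⟩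
  ∣ m / d * d - n / d * d ∣                  ≡⟨ *-distribʳ-∣-∣ d (m / d) (n / d) ⟨
  ∣ m / d - n / d ∣ * d                      ∎)
  where open ≡-Reasoning

∣∣-∣⇒%≡% : ∀ d .{{_ : NonZero d}} m n → d ∣ ∣ m - n ∣ → m % d ≡ n % d
∣∣-∣⇒%≡% d m n d∣∣m-n∣ =
  [ (λ m≤n → sym (upper≡lower m≤n d∣∣m-n∣))
  , (λ n≤m → upper≡lower n≤m (subst (d ∣_) (∣-∣-comm m n) d∣∣m-n∣))
  ]′ (≤-total m n)
  where
  upper≡lower : ∀ {a b} → a ≤ b → d ∣ ∣ a - b ∣ → b % d ≡ a % d
  upper≡lower {a} {b} a≤b d∣∣a-b∣ = begin
    b % d              ≡⟨ cong (_% d) (m+[n∸m]≡n a≤b) ⟨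
    (a + (b ∸ a)) % d  ≡⟨ %-remove-+ʳ a (subst (d ∣_) (m≤n⇒∣m-n∣≡n∸m a≤b) d∣∣a-b∣) ⟩
    a % d              ∎
    where open ≡-Reasoning

∣∧<⇒≡0 : ∀ {d m} .{{_ : NonZero d}} → d ∣ m → m < d → m ≡ 0
∣∧<⇒≡0 {d} {m} d∣m m<d = trans (sym (m<n⇒m%n≡m m<d)) (n∣m⇒m%n≡0 m d d∣m)

prime-divisor : ∀ {m} → 1 < m → ∃[ p ] Prime p × p ∣ m
prime-divisor {suc m} 1<m with factorise (suc m)
... | record { factors = [] ; isFactorisation = m≡1 } = ⊥-elim (<-irrefl (sym m≡1) 1<m)
... | record { factors = p ∷ ps ; isFactorisation = m≡p*ps ; factorsPrime = p-prime ∷ _ } =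
  p , p-prime , subst (p ∣_) (sym m≡p*ps) (m∣m*n (product ps))

PrimeDivisorsAmong : ℕ → ℕ → ℕ → Set
PrimeDivisorsAmong n p q = ∀ r → Prime r → r ∣ n → r ≡ p ⊎ r ≡ q

module Residues {n p q : ℕ} .{{_ : NonZero n}} (p-prime : Prime p) (p∣n : p ∣ n) (p≤q : p ≤ q)
  (among : PrimeDivisorsAmong n p q) where

  1<p : 1 < p
  1<p = nonTrivial⇒n>1 p {{prime⇒nonTrivial p-prime}}

  instance
    p-nonZero : NonZero p
    p-nonZero = prime⇒nonZero p-prime
    q-nonZero : NonZero q
    q-nonZero = >-nonZero (<-≤-trans (<-trans z<s 1<p) p≤q)

  row col level : Fin n → ℕ
  row   x = toℕ x % p
  col   x = toℕ x % q
  level x = toℕ x / p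

  decompose : ∀ x → toℕ x ≡ level x * p + row x
  decompose x = trans (m≡m%n+[m/n]*n (toℕ x) p) (+-comm (row x) _)

  row-injective : ∀ {u v} → row u ≡ row v → level u ≡ level v → u ≡ v
  row-injective {u} {v} row-uv level-uv = toℕ-injective (begin
    toℕ u                ≡⟨ decompose u ⟩
    level u * p + row u  ≡⟨ cong₂ (λ l r → l * p + r) level-uv row-uv ⟩
    level v * p + row v  ≡⟨ decompose v ⟨
    toℕ v                ∎)
    where open ≡-Reasoning

  col-injective : ∀ {u v} → col u ≡ col v → level u ≡ level v → u ≡ v
  col-injective {u} {v} col-uv level-uv =
    toℕ-injective (∣m-n∣≡0⇒m≡n (∣∧<⇒≡0 (%≡%⇒∣∣-∣ q (toℕ u) (toℕ v) col-uv) ∣u-v∣<q))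
    where
    open ≤-Reasoning
    ∣u-v∣<q : ∣ toℕ u - toℕ v ∣ < q
    ∣u-v∣<q = begin-strict
      ∣ toℕ u - toℕ v ∣                              ≡⟨ cong₂ ∣_-_∣ (decompose u) (decompose v) ⟩
      ∣ level u * p + row u - level v * p + row v ∣  ≡⟨ cong (λ l → ∣ level u * p + row u - l * p + row v ∣) level-uv ⟨
      ∣ level u * p + row u - level u * p + row v ∣  ≡⟨ ∣m+n-m+o∣≡∣n-o∣ (level u * p) (row u) (row v) ⟩
      ∣ row u - row v ∣                              ≤⟨ ∣m-n∣≤m⊔n (row u) (row v) ⟩
      row u ⊔ row v                                  <⟨ ⊔-pres-<m (m%n<n (toℕ u) p) (m%n<n (toℕ v) p) ⟩
      p                                              ≤⟨ p≤q ⟩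
      q                                              ∎

  level<n/p : ∀ u → level u < n / p
  level<n/p u = m<n*o⇒m/o<n (subst (toℕ u <_) (sym (m/n*n≡m p∣n)) (toℕ<n u))

  prime∣diff⇒same-row⊎col : ∀ {u v r} → Prime r → r ∣ n → r ∣ ∣ toℕ u - toℕ v ∣ →
                            row u ≡ row v ⊎ col u ≡ col v
  prime∣diff⇒same-row⊎col {u} {v} r-prime r∣n r∣diff with among _ r-prime r∣n
  ... | inj₁ refl = inj₁ (∣∣-∣⇒%≡% p (toℕ u) (toℕ v) r∣diff)
  ... | inj₂ refl = inj₂ (∣∣-∣⇒%≡% q (toℕ u) (toℕ v) r∣diff)

  coUnitaryCayley⊆rook : ∀ {u v} → CoUnitaryCayley n u v → Rook row col u v
  coUnitaryCayley⊆rook {u} {v} (u≢v , gcd>1) =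
    let r , r-prime , r∣gcd = prime-divisor gcd>1
    in u≢v , prime∣diff⇒same-row⊎col r-prime (∣-trans r∣gcd (gcd[m,n]∣n ∣ toℕ u - toℕ v ∣ n))
                                              (∣-trans r∣gcd (gcd[m,n]∣m ∣ toℕ u - toℕ v ∣ n))

  choosable : Choosable (CoUnitaryCayley n) (n / p)
  choosable = choosable-⊆ coUnitaryCayley⊆rook
    (Galvin.rook-choosable row col level row-injective col-injective level<n/p)

  multiple : Fin (n / p) → Fin n
  multiple t = fromℕ< (subst (toℕ t * p <_) (m/n*n≡m p∣n) (*-monoˡ-< p (toℕ<n t)))

  toℕ-multiple : ∀ t → toℕ (multiple t) ≡ toℕ t * p
  toℕ-multiple t = toℕ-fromℕ< _

  multiples-clique : ∀ {t s} → t ≢ s → CoUnitaryCayley n (multiple t) (multiple s)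
  multiples-clique {t} {s} t≢s = t≢s ∘ multiple-injective , gcd>1
    where
    diff : ℕ
    diff = ∣ toℕ (multiple t) - toℕ (multiple s) ∣
    multiple-injective : multiple t ≡ multiple s → t ≡ s
    multiple-injective eq = toℕ-injective (*-cancelʳ-≡ (toℕ t) (toℕ s) p
      (trans (sym (toℕ-multiple t)) (trans (cong toℕ eq) (toℕ-multiple s))))
    p∣diff : p ∣ diff
    p∣diff = divides ∣ toℕ t - toℕ s ∣ (begin
      diff                                     ≡⟨ cong₂ ∣_-_∣ (toℕ-multiple t) (toℕ-multiple s) ⟩
      ∣ toℕ t * p - toℕ s * p ∣                ≡⟨ *-distribʳ-∣-∣ p (toℕ t) (toℕ s) ⟨
      ∣ toℕ t - toℕ s ∣ * p                    ∎)
      where open ≡-Reasoning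
    instance
      gcd-nonZero : NonZero (gcd diff n)
      gcd-nonZero = ≢-nonZero (gcd[m,n]≢0 diff n (inj₂ (≢-nonZero⁻¹ n)))
    gcd>1 : 1 < gcd diff n
    gcd>1 = <-≤-trans 1<p (∣⇒≤ (gcd-greatest p∣diff p∣n))

  colourable⇒n/p≤ : ∀ j → Colorable (CoUnitaryCayley n) j → n / p ≤ j
  colourable⇒n/p≤ j = clique⇒≤ multiple multiples-clique

two-prime-divisors : ∀ {n} → 1 < n → AtMostTwoPrimeDivisors n →
                     ∃[ p ] ∃[ q ] Prime p × Prime q × (p ∣ n) × (q ∣ n) × PrimeDivisorsAmong n p q
two-prime-divisors {n} 1<n at-most-two with prime-divisor 1<n
... | p , p-prime , p∣n with anyUpTo? (λ r → prime? r ×-dec (r ∣? n) ×-dec r ≢? p) (suc n)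
...   | yes (q , _ , q-prime , q∣n , q≢p) = p , q , p-prime , q-prime , p∣n , q∣n , among
  where
  among : PrimeDivisorsAmong n p q
  among r r-prime r∣n with at-most-two p q r p-prime q-prime r-prime p∣n q∣n r∣n
  ... | inj₁ p≡q        = ⊥-elim (q≢p (sym p≡q))
  ... | inj₂ (inj₁ p≡r) = inj₁ (sym p≡r)
  ... | inj₂ (inj₂ q≡r) = inj₂ (sym q≡r)
...   | no no-other = p , p , p-prime , p-prime , p∣n , p∣n , among
  where
  instance
    n-nonZero : NonZero n
    n-nonZero = >-nonZero (<-trans z<s 1<n)
  among : PrimeDivisorsAmong n p p
  among r r-prime r∣n with r ≟ p
  ... | yes r≡p = inj₁ r≡p
  ... | no r≢p  = ⊥-elim (no-other (r , s≤s (∣⇒≤ r∣n) , r-prime , r∣n , r≢p))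

ordered-prime-divisors : ∀ {n} → 1 < n → AtMostTwoPrimeDivisors n →
                         ∃[ p ] ∃[ q ] Prime p × (p ∣ n) × p ≤ q × PrimeDivisorsAmong n p q
ordered-prime-divisors 1<n at-most-two with two-prime-divisors 1<n at-most-two
... | p , q , p-prime , q-prime , p∣n , q∣n , among with ≤-total p q
...   | inj₁ p≤q = p , q , p-prime , p∣n , p≤q , among
...   | inj₂ q≤p = q , p , q-prime , q∣n , q≤p , λ r r-prime r∣n → swap (among r r-prime r∣n)

mainTheorem2 : (n : ℕ) → n > 1 → ¬ (2 ∣ n) → AtMostTwoPrimeDivisors n →
    (k : ℕ) → ChromaticNumber (CoUnitaryCayley n) k → ChoiceNumber (CoUnitaryCayley n) k
mainTheorem2 n 1<n _ at-most-two k χ with ordered-prime-divisors 1<n at-most-two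
... | p , q , p-prime , p∣n , p≤q , among =
  chromaticNumber⇒choiceNumber choosable colourable⇒n/p≤ χ
  where
  open Residues {{>-nonZero (<-trans z<s 1<n)}} p-prime p∣n p≤q among
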